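{- Let $G$ be an $n$-vertex almost $r$-regular graph for some integer $r\ge 0$, and let $x$ be the vertex of $G$ of degree $r+1$. Then the complement $\overline{G}$ has a matching that does not cover $x$ and covers at least $n-\frac{n}{n-r}-3$ vertices of $\overline{G}$.
   Context: A graph $G$ is almost $r$-regular if exactly one vertex has degree $r+1$ and all other vertices have degree $r$. $\overline{G}$ denotes the complement of the simple graph $G$. -}

module Defs where

open import Data.Nat using (ℕ; suc; _+_; _*_; _∸_; _≤_)
open import Data.Bool using (Bool; true; false; not; _∧_)
open import Data.Fin using (Fin; _≟_)
open import Data.List using (List; []; _∷_; length; filter; concatMap; allFin)
open import Data.List.Relation.Unary.All using (All)
open import Data.List.Relation.Unary.Unique.Propositional using (Unique)
open import Data.List.Membership.Propositional using (_∉_)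
open import Data.Product using (_×_; _,_)
open import Relation.Binary.PropositionalEquality using (_≡_; _≢_)
open import Relation.Nullary.Decidable using (⌊_⌋)
open import Data.Bool using (T)

record Graph (n : ℕ) : Set where
  field
    adj   : Fin n → Fin n → Bool
    sym   : ∀ u v → adj u v ≡ adj v u
    irrefl : ∀ v → adj v v ≡ false
open Graph public

degree : ∀ {n} → Graph n → Fin n → ℕ
degree G v = length (filter (λ u → T? (adj G v u)) (allFin _))
  where
  open import Data.Bool.Properties using () renaming (T? to T?)

AlmostRegularAt : ∀ {n} → Graph n → ℕ → Fin n → Set
AlmostRegularAt G r x = (degree G x ≡ suc r) × (∀ v → v ≢ x → degree G v ≡ r)

complAdj : ∀ {n} → Graph n → Fin n → Fin n → Bool
complAdj G u v = not (adj G u v) ∧ not ⌊ u ≟ v ⌋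

covered : ∀ {n} → List (Fin n × Fin n) → List (Fin n)
covered = concatMap (λ { (u , v) → u ∷ v ∷ [] })

IsComplMatching : ∀ {n} → Graph n → List (Fin n × Fin n) → Set
IsComplMatching G M = All (λ { (u , v) → T (complAdj G u v) }) M × Unique (covered M)

{-# OPTIONS --safe #-}

-- The complement Ḡ has maximum degree D = n - r - 1: every vertex other than x has degree D
-- and x has degree D - 1, so the degree sum of Ḡ is n D - 1. By Vizing's theorem the edges of
-- Ḡ have a proper colouring with D + 1 = n - r colours, and double counting gives a colour c
-- met by at least (n D - 1) / (D + 1) vertices. The edges of colour c form a matching;
-- dropping its edge at x loses at most two vertices, which leaves n - n / (n - r) - 3.
--
-- Vizing's theorem is proved by colouring one edge u v₀ at a time with a fan at u: vⱼ₊₁ is the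
-- neighbour of u along the colour missing at vⱼ. When the fan reaches a colour also missing at
-- u, shifting colours down the fan colours u v₀. When it returns to an earlier vertex, an α/β
-- swap on the alternating path from u first makes the repeated colour β free at u.

module Submission where

open import Level using (0ℓ)
open import Function using (_∘_)
open import Data.Empty using (⊥; ⊥-elim)
open import Data.Bool using (Bool; true; false; T; not; if_then_else_)
open import Data.Bool.Properties using (T?; ∧-zeroʳ; not-involutive)
open import Data.Nat using (ℕ; zero; suc; _+_; _*_; _∸_; _≤_; _<_; z≤n; s≤s) renaming (_≟_ to _≟ℕ_)
open import Data.Nat.Properties hiding (_≟_)
open import Data.Nat.Tactic.RingSolver using (solve-∀)
open import Data.Fin as Fin using (Fin; zero; suc; toℕ; _≟_)
import Data.Fin.Properties as Finₚ
open import Data.Fin.Properties using (any?; pigeonhole)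
open import Data.Fin.Permutation.Components using (transpose)
open import Data.Maybe as Maybe using (Maybe; just; nothing; fromMaybe; _>>=_)
open import Data.Maybe.Properties using (just-injective) renaming (≡-dec to ≡-decM)
open import Data.Product as Product using (Σ; ∃; ∃₂; _×_; _,_; proj₁; proj₂)
open import Data.Sum using (_⊎_; inj₁; inj₂)
open import Data.List using (List; []; _∷_; length; map; filter; _++_; allFin; tabulate; cartesianProduct)
open import Data.List.Properties using (length-++; length-map; length-tabulate)
open import Data.List.Membership.Propositional using (_∈_; _∉_)
open import Data.List.Membership.Propositional.Properties
  using (∈-∃++; ∈-++⁻; ∈-++⁺ˡ; ∈-++⁺ʳ; ∈-map⁺; ∈-map⁻; ∈-filter⁺; ∈-filter⁻; ∈-allFin; ∈-cartesianProduct⁺)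
open import Data.List.Relation.Binary.Subset.Propositional using (_⊆_)
open import Data.List.Relation.Unary.Any using (here; there)
open import Data.List.Relation.Unary.All as All using (All)
import Data.List.Relation.Unary.All.Properties as All
open import Data.List.Relation.Unary.AllPairs using ([]; _∷_)
open import Data.List.Relation.Unary.Unique.Propositional using (Unique)
import Data.List.Relation.Unary.Unique.Propositional.Properties as Unique
open import Relation.Nullary using (¬_; Dec; yes; no; does; ¬?; contradiction)
open import Relation.Nullary.Decidable using (map′; isYes≗does; dec-true; dec-false; does-≡; _×-dec_; _⊎-dec_)
open import Relation.Unary using (Pred; Decidable)
open import Relation.Binary.Definitions using (tri<; tri≈; tri>)
open import Relation.Binary.PropositionalEquality
open import Algebra.Properties.CommutativeMonoid.Sum +-0-commutativeMonoid
  using (sum-syntax; sum-cong-≗; ∑-comm; ∑-distrib-+)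

open import Defs hiding (sym)

module _ {A : Set} where

  unique-⊆⇒length≤ : {xs ys : List A} → Unique xs → xs ⊆ ys → length xs ≤ length ys
  unique-⊆⇒length≤ {[]} _ _ = z≤n
  unique-⊆⇒length≤ {a ∷ xs} (a∉xs ∷ xs!) xs⊆ys with ∈-∃++ (xs⊆ys (here refl))
  ... | as , bs , refl = begin
    suc (length xs)          ≤⟨ s≤s (unique-⊆⇒length≤ xs! xs⊆as++bs) ⟩
    suc (length (as ++ bs))  ≡⟨ cong suc (length-++ as) ⟩
    suc (length as + length bs) ≡⟨ +-suc (length as) (length bs) ⟨
    length as + length (a ∷ bs) ≡⟨ length-++ as ⟨
    length (as ++ a ∷ bs)    ∎
    where
    open ≤-Reasoning
    xs⊆as++bs : xs ⊆ as ++ bs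
    xs⊆as++bs z∈xs with ∈-++⁻ as (xs⊆ys (there z∈xs))
    ... | inj₁ z∈as = ∈-++⁺ˡ z∈as
    ... | inj₂ (here refl) = ⊥-elim (All.lookup a∉xs z∈xs refl)
    ... | inj₂ (there z∈bs) = ∈-++⁺ʳ as z∈bs

module _ {Q : Pred ℕ 0ℓ} (Q? : Decidable Q) where

  least-witness : ∀ k → (∃ λ m → m < k × Q m) → ∃ λ m → Q m × (∀ {j} → j < m → ¬ Q j)
  least-witness (suc k) w with anyUpTo? Q? k
  ... | yes w′ = least-witness k w′
  ... | no none with w
  ...   | m , m<1+k , Qm = m , Qm , λ j<m Qj → none (_ , <-≤-trans j<m (≤-pred m<1+k) , Qj)

indicator : ∀ {A : Set} → Dec A → ℕ
indicator a? = if does a? then 1 else 0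

length-filter-tabulate : ∀ {A : Set} {P : Pred A 0ℓ} (P? : Decidable P) {n} (f : Fin n → A) →
  length (filter P? (tabulate f)) ≡ ∑[ i < n ] indicator (P? (f i))
length-filter-tabulate P? {zero} f = refl
length-filter-tabulate P? {suc n} f with does (P? (f zero))
... | true = cong suc (length-filter-tabulate P? (λ i → f (suc i)))
... | false = length-filter-tabulate P? (λ i → f (suc i))

length-filter-allFin : ∀ {n} {P : Pred (Fin n) 0ℓ} (P? : Decidable P) →
  length (filter P? (allFin n)) ≡ ∑[ i < n ] indicator (P? i)
length-filter-allFin P? = length-filter-tabulate P? (λ i → i)

∑-mono-≤ : ∀ {n} {f g : Fin n → ℕ} → (∀ i → f i ≤ g i) → ∑[ i < n ] f i ≤ ∑[ i < n ] g i
∑-mono-≤ {zero} f≤g = z≤n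
∑-mono-≤ {suc n} f≤g = +-mono-≤ (f≤g zero) (∑-mono-≤ (λ i → f≤g (suc i)))

∑≤length*max : ∀ {n} (f : Fin (suc n) → ℕ) → ∃ λ i → ∑[ j < suc n ] f j ≤ suc n * f i
∑≤length*max {zero} f = zero , ≤-refl
∑≤length*max {suc n} f with ∑≤length*max (λ j → f (suc j))
... | i , ∑≤ with f (suc i) ≤? f zero
...   | yes fi≤f0 = zero , +-monoʳ-≤ (f zero) (≤-trans ∑≤ (*-monoʳ-≤ (suc n) fi≤f0))
...   | no fi≰f0 = suc i , +-mono-≤ (<⇒≤ (≰⇒> fi≰f0)) ∑≤

*≤∑ : ∀ {n} {f : Fin n → ℕ} {d} → (∀ i → d ≤ f i) → n * d ≤ ∑[ i < n ] f i
*≤∑ {zero} d≤f = z≤n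
*≤∑ {suc n} d≤f = +-mono-≤ (d≤f zero) (*≤∑ (λ i → d≤f (suc i)))

*≤1+∑-except : ∀ {n} {f : Fin n → ℕ} {d} x → (∀ i → i ≢ x → d ≤ f i) → d ≤ suc (f x) →
  n * d ≤ suc (∑[ i < n ] f i)
*≤1+∑-except zero d≤f d≤1+fx = +-mono-≤ d≤1+fx (*≤∑ (λ i → d≤f (suc i) λ ()))
*≤1+∑-except {suc n} {f} {d} (suc x) d≤f d≤1+fx = begin
  suc n * d                           ≤⟨ +-mono-≤ (d≤f zero λ ()) (*≤1+∑-except x d≤f∘suc d≤1+fx) ⟩
  f zero + suc (∑[ i < n ] f (suc i)) ≡⟨ +-suc (f zero) _ ⟩
  suc (∑[ i < suc n ] f i)            ∎
  where
  open ≤-Reasoning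
  d≤f∘suc : ∀ i → i ≢ x → d ≤ f (suc i)
  d≤f∘suc i i≢x = d≤f (suc i) (i≢x ∘ Finₚ.suc-injective)

∑1≡n : ∀ n → ∑[ i < n ] 1 ≡ n
∑1≡n zero = refl
∑1≡n (suc n) = cong suc (∑1≡n n)

1+∑-indicator-≢ : ∀ {n} (v : Fin n) → suc (∑[ u < n ] indicator (¬? (v ≟ u))) ≡ n
1+∑-indicator-≢ {suc n} zero = cong suc (∑1≡n n)
1+∑-indicator-≢ (suc v) = cong suc (1+∑-indicator-≢ v)

module _ {k} (i j : Fin k) where

  transpose-i : transpose i j i ≡ j
  transpose-i rewrite dec-true (i ≟ i) refl = refl

  transpose-j : transpose i j j ≡ i
  transpose-j with j ≟ i
  ... | yes j≡i = j≡i
  ... | no _ rewrite dec-true (j ≟ j) refl = refl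

  transpose-other : ∀ {l} → l ≢ i → l ≢ j → transpose i j l ≡ l
  transpose-other {l} l≢i l≢j rewrite dec-false (l ≟ i) l≢i | dec-false (l ≟ j) l≢j = refl

  transpose-moves-or-fixes : ∀ l → (l ≡ i ⊎ l ≡ j) ⊎ transpose i j l ≡ l
  transpose-moves-or-fixes l = by-cases (l ≟ i) (l ≟ j)
    where
    by-cases : Dec (l ≡ i) → Dec (l ≡ j) → (l ≡ i ⊎ l ≡ j) ⊎ transpose i j l ≡ l
    by-cases (yes l≡i) _ = inj₁ (inj₁ l≡i)
    by-cases (no _) (yes l≡j) = inj₁ (inj₂ l≡j)
    by-cases (no l≢i) (no l≢j) = inj₂ (transpose-other l≢i l≢j)

  transpose-involutive : ∀ l → transpose i j (transpose i j l) ≡ l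
  transpose-involutive l with transpose-moves-or-fixes l
  ... | inj₁ (inj₁ refl) = trans (cong (transpose i j) transpose-i) transpose-j
  ... | inj₁ (inj₂ refl) = trans (cong (transpose i j) transpose-j) transpose-i
  ... | inj₂ fixed = trans (cong (transpose i j) fixed) fixed

complement : ∀ {n} → Graph n → Graph n
complement G = record { adj = complAdj G ; sym = complAdj-sym ; irrefl = complAdj-irrefl }
  where
  complAdj-sym : ∀ a b → complAdj G a b ≡ complAdj G b a
  complAdj-sym a b
    rewrite Graph.sym G a b | isYes≗does (a ≟ b) | isYes≗does (b ≟ a)
          | does-≡ (a ≟ b) (map′ sym sym (b ≟ a)) = refl
  complAdj-irrefl : ∀ a → complAdj G a a ≡ false
  complAdj-irrefl a rewrite isYes≗does (a ≟ a) | dec-true (a ≟ a) refl = ∧-zeroʳ _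

degree≡∑ : ∀ {n} (G : Graph n) v → degree G v ≡ ∑[ u < n ] indicator (T? (adj G v u))
degree≡∑ G v = length-filter-allFin (λ u → T? (adj G v u))

module _ {n} (G : Graph n) where

  indicator-adj+complAdj : ∀ v u →
    indicator (T? (adj G v u)) + indicator (T? (complAdj G v u)) ≡ indicator (¬? (v ≟ u))
  indicator-adj+complAdj v u with v ≟ u
  ... | yes refl rewrite irrefl G v = refl
  ... | no _ with adj G v u
  ...   | true = refl
  ...   | false = refl

  degree+degree-complement : ∀ v → suc (degree G v + degree (complement G) v) ≡ n
  degree+degree-complement v = begin
    suc (degree G v + degree (complement G) v)
      ≡⟨ cong suc (cong₂ _+_ (degree≡∑ G v) (degree≡∑ (complement G) v)) ⟩
    suc (∑[ u < n ] indicator (T? (adj G v u)) + ∑[ u < n ] indicator (T? (complAdj G v u)))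
      ≡⟨ cong suc (∑-distrib-+ (indicator ∘ T? ∘ adj G v) (indicator ∘ T? ∘ complAdj G v)) ⟨
    suc (∑[ u < n ] (indicator (T? (adj G v u)) + indicator (T? (complAdj G v u))))
      ≡⟨ cong suc (sum-cong-≗ {n} (indicator-adj+complAdj v)) ⟩
    suc (∑[ u < n ] indicator (¬? (v ≟ u)))
      ≡⟨ 1+∑-indicator-≢ v ⟩
    n ∎
    where open ≡-Reasoning

module EdgeColouring {n} (H : Graph n) (K : ℕ) where

  Colouring : Set
  Colouring = Fin n → Fin n → Maybe (Fin K)

  Coloured : Colouring → Fin n → Fin n → Set
  Coloured κ a b = ∃ λ c → κ a b ≡ just c

  Missing : Colouring → Fin n → Fin K → Set
  Missing κ v c = ∀ b → κ v b ≢ just c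

  record Proper (κ : Colouring) : Set where
    field
      symmetric : ∀ a b → κ a b ≡ κ b a
      only-edges : ∀ {a b c} → κ a b ≡ just c → T (adj H a b)
      injective : ∀ {a b b′ c} → κ a b ≡ just c → κ a b′ ≡ just c → b ≡ b′
  open Proper public

  Extends : Colouring → Colouring → Set
  Extends κ κ′ = ∀ {a b} → Coloured κ a b → Coloured κ′ a b

  Total : Colouring → Set
  Total κ = ∀ {a b} → T (adj H a b) → Coloured κ a b

  coloured-sym : ∀ {κ} → Proper κ → ∀ {a b c} → κ a b ≡ just c → κ b a ≡ just c
  coloured-sym P {a} {b} κab = trans (symmetric P b a) κab

  no-loop : ∀ {a} → ¬ T (adj H a a)
  no-loop {a} = subst T (irrefl H a)

  loop-free : ∀ {κ} → Proper κ → ∀ {a c} → κ a a ≢ just c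
  loop-free P = no-loop ∘ only-edges P

  present? : ∀ (κ : Colouring) v c → Dec (∃ λ b → κ v b ≡ just c)
  present? κ v c = any? (λ b → ≡-decM _≟_ (κ v b) (just c))

  opaque
    neighbour : Colouring → Fin K → Fin n → Maybe (Fin n)
    neighbour κ c v with present? κ v c
    ... | yes (b , _) = just b
    ... | no _ = nothing

    neighbour-just : ∀ {κ c v b} → neighbour κ c v ≡ just b → κ v b ≡ just c
    neighbour-just {κ} {c} {v} eq with present? κ v c
    neighbour-just refl | yes (_ , κvb≡c) = κvb≡c

    neighbour-nothing : ∀ {κ c v} → neighbour κ c v ≡ nothing → Missing κ v c
    neighbour-nothing {κ} {c} {v} eq with present? κ v c
    neighbour-nothing refl | no absent = λ b κvb≡c → absent (b , κvb≡c)

    neighbour-complete : ∀ {κ} → Proper κ → ∀ {c v b} → κ v b ≡ just c → neighbour κ c v ≡ just b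
    neighbour-complete {κ} P {c} {v} κvb≡c with present? κ v c
    ... | yes (_ , κvb′≡c) = cong just (injective P κvb′≡c κvb≡c)
    ... | no absent = contradiction (_ , κvb≡c) absent

  partner : Colouring → Fin K → Fin n → Fin n
  partner κ c v = fromMaybe v (neighbour κ c v)

  partner-of : ∀ {κ} → Proper κ → ∀ {c v w} → κ v w ≡ just c → partner κ c v ≡ w
  partner-of P κvw = cong (fromMaybe _) (neighbour-complete P κvw)

  partner-coloured : ∀ {κ} → Proper κ → ∀ {c v b} → κ v b ≡ just c → κ v (partner κ c v) ≡ just c
  partner-coloured {κ} P {c} {v} κvb = subst (λ w → κ v w ≡ just c) (sym (partner-of P κvb)) κvb

  missing-colour : ∀ {κ} → Proper κ → ∀ v → degree H v < K → ∃ (Missing κ v)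
  missing-colour {κ} P v deg<K with any? (λ c → ¬? (present? κ v c))
  ... | yes (c , absent) = c , λ b κvb≡c → absent (b , κvb≡c)
  ... | no none = contradiction K≤deg (<⇒≱ deg<K)
    where
    all-present : ∀ c → κ v (partner κ c v) ≡ just c
    all-present c with present? κ v c
    ... | yes (_ , κvb≡c) = partner-coloured P κvb≡c
    ... | no absent = contradiction (c , absent) none
    partners-injective : ∀ {c c′} → partner κ c v ≡ partner κ c′ v → c ≡ c′
    partners-injective {c} {c′} eq = just-injective
      (trans (sym (all-present c)) (trans (cong (κ v) eq) (all-present c′)))
    partners⊆neighbours : map (λ c → partner κ c v) (allFin K) ⊆ filter (T? ∘ adj H v) (allFin n)
    partners⊆neighbours b∈ with ∈-map⁻ (λ c → partner κ c v) b∈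
    ... | c , _ , refl = ∈-filter⁺ (λ u → T? (adj H v u)) (∈-allFin _) (only-edges P (all-present c))
    K≤deg : K ≤ degree H v
    K≤deg = subst (_≤ degree H v) (trans (length-map _ (allFin K)) (length-tabulate {n = K} (λ i → i)))
      (unique-⊆⇒length≤ (Unique.map⁺ partners-injective (Unique.allFin⁺ K)) partners⊆neighbours)

  missing⇒neighbour-nothing : ∀ {κ c v} → Missing κ v c → neighbour κ c v ≡ nothing
  missing⇒neighbour-nothing {κ} {c} {v} c∉v with neighbour κ c v in eq
  ... | nothing = refl
  ... | just b = contradiction (neighbour-just eq) (c∉v b)

  module KempeChain {κ} (P : Proper κ) (x : Fin n) {α β : Fin K} (α≢β : α ≢ β) (α∉x : Missing κ x α) where

    σ : Fin K → Fin K
    σ = transpose α β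

    even : ℕ → Bool
    even zero = true
    even (suc j) = not (even j)

    colour : ℕ → Fin K
    colour j = if even j then β else α

    colour-ssuc : ∀ j → colour (suc (suc j)) ≡ colour j
    colour-ssuc j rewrite not-involutive (even j) = refl

    colour-other : ∀ {c} j → c ≡ α ⊎ c ≡ β → c ≢ colour (suc j) → c ≡ colour j
    colour-other j c∈αβ c≢ with even j
    colour-other j (inj₁ refl) c≢ | true = contradiction refl c≢
    colour-other j (inj₂ refl) c≢ | true = refl
    colour-other j (inj₁ refl) c≢ | false = refl
    colour-other j (inj₂ refl) c≢ | false = contradiction refl c≢

    colour∈αβ : ∀ j → colour j ≡ α ⊎ colour j ≡ β
    colour∈αβ j with even j
    ... | true = inj₂ refl
    ... | false = inj₁ refl

    -- The alternating β/α path from x, which is undefined from its end on.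
    chain : ℕ → Maybe (Fin n)
    chain zero = just x
    chain (suc j) = chain j >>= neighbour κ (colour j)

    chain-suc : ∀ j {b} → chain (suc j) ≡ just b → ∃ λ a → chain j ≡ just a × κ a b ≡ just (colour j)
    chain-suc j eq with chain j
    ... | just a = a , refl , neighbour-just eq

    chain-step : ∀ j {a b} → chain j ≡ just a → κ a b ≡ just (colour j) → chain (suc j) ≡ just b
    chain-step j eq κab rewrite eq = neighbour-complete P κab

    chain-prefix : ∀ i j {b} → i ≤ j → chain j ≡ just b → ∃ λ a → chain i ≡ just a
    chain-prefix i j {b} i≤j eq with m≤n⇒m<n∨m≡n i≤j
    ... | inj₂ refl = b , eq
    chain-prefix i (suc j) i≤j eq | inj₁ i<1+j with chain-suc j eq
    ... | a , eq′ , _ = chain-prefix i j (≤-pred i<1+j) eq′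

    colour-at-x : ∀ j {p} → κ x p ≡ just (colour j) → colour j ≡ β
    colour-at-x j {p} κxp with colour∈αβ j
    ... | inj₁ cj≡α = contradiction (trans κxp (cong just cj≡α)) (α∉x p)
    ... | inj₂ cj≡β = cj≡β

    chain-injective : ∀ {i j a} → i < j → chain i ≡ just a → chain j ≡ just a → ⊥
    chain-injective {zero} {suc j} _ refl xj with chain-suc j xj
    ... | p , pj , κpx = revisit-x j pj cj≡β
      where
      cj≡β : colour j ≡ β
      cj≡β = colour-at-x j (coloured-sym P κpx)
      κxp : κ x p ≡ just β
      κxp = coloured-sym P (trans κpx (cong just cj≡β))
      revisit-x : ∀ k → chain k ≡ just p → colour k ≡ β → ⊥
      revisit-x zero refl _ = loop-free P κxp
      revisit-x (suc zero) _ α≡β = α≢β α≡β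
      revisit-x (suc (suc k)) pk _ =
        chain-injective {j = suc (suc k)} (s≤s (s≤s z≤n)) (chain-step 0 refl κxp) pk
    chain-injective {suc i} {suc j} {a} (s≤s i<j) ai aj with chain-suc i ai | chain-suc j aj
    ... | p , pi , κpa | q , qj , κqa with colour i ≟ colour j
    ...   | yes ci≡cj = chain-injective i<j pi (trans qj (cong just q≡p))
      where
      q≡p : q ≡ p
      q≡p = injective P (coloured-sym P κqa) (coloured-sym P (trans κpa (cong just ci≡cj)))
    ...   | no ci≢cj = after-a (m≤n⇒m<n∨m≡n i<j)
      where
      cj≡c1+i : colour j ≡ colour (suc i)
      cj≡c1+i = colour-other (suc i) (colour∈αβ j) (λ eq → ci≢cj (sym (trans eq (colour-ssuc i))))
      next : chain (suc (suc i)) ≡ just q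
      next = chain-step (suc i) ai (coloured-sym P (trans κqa (cong just cj≡c1+i)))
      after-a : suc i < j ⊎ suc i ≡ j → ⊥
      after-a (inj₂ refl) with just-injective (trans (sym ai) qj)
      ... | refl = loop-free P κqa
      after-a (inj₁ 1+i<j) with m≤n⇒m<n∨m≡n 1+i<j
      ... | inj₂ refl = ci≢cj (sym (colour-ssuc i))
      ... | inj₁ 2+i<j = chain-injective 2+i<j next qj

    chain-ends : chain n ≡ nothing
    chain-ends with chain n in eq
    ... | nothing = refl
    ... | just a = contradiction (pigeonhole ≤-refl vertex) no-repeat
      where
      defined : ∀ (i : Fin (suc n)) → ∃ λ b → chain (toℕ i) ≡ just b
      defined i = chain-prefix (toℕ i) n (≤-pred (Finₚ.toℕ<n i)) eq
      vertex : Fin (suc n) → Fin n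
      vertex i = proj₁ (defined i)
      no-repeat : ¬ ∃₂ λ i j → i Fin.< j × vertex i ≡ vertex j
      no-repeat (i , j , i<j , same) =
        chain-injective i<j (proj₂ (defined i)) (trans (proj₂ (defined j)) (cong just (sym same)))

    -- Bounding the index by n loses nothing, by chain-ends.
    OnChain : Fin n → Set
    OnChain v = ∃ λ j → j < n × chain j ≡ just v

    onChain? : ∀ v → Dec (OnChain v)
    onChain? v = anyUpTo? (λ j → ≡-decM _≟_ (chain j) (just v)) n

    x-onChain : OnChain x
    x-onChain = 0 , ≤-<-trans z≤n (Finₚ.toℕ<n x) , refl

    chain-closed : ∀ {a b c} → OnChain a → κ a b ≡ just c → c ≡ α ⊎ c ≡ β → OnChain b
    chain-closed {a} {b} {c} (j , j<n , aj) κab c∈αβ with c ≟ colour j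
    ... | yes refl = suc j , still-defined , bj
      where
      bj : chain (suc j) ≡ just b
      bj = chain-step j aj κab
      still-defined : suc j < n
      still-defined with m≤n⇒m<n∨m≡n j<n
      ... | inj₁ 1+j<n = 1+j<n
      ... | inj₂ refl with () ← trans (sym bj) chain-ends
    chain-closed {b = b} (zero , _ , refl) κxb (inj₁ refl) | no _ = contradiction κxb (α∉x b)
    chain-closed (zero , _ , refl) κxb (inj₂ refl) | no c≢β = contradiction refl c≢β
    chain-closed {a} {b} {c} (suc j , 1+j<n , aj) κab c∈αβ | no c≢colour with chain-suc j aj
    ... | p , pj , κpa = j , <-trans (n<1+n j) 1+j<n , trans pj (cong just (sym b≡p))
      where
      b≡p : b ≡ p
      b≡p = injective P κab (coloured-sym P (trans κpa (cong just (sym (colour-other j c∈αβ c≢colour)))))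

    opaque
      swapped : Colouring
      swapped a b with onChain? a
      ... | yes _ = Maybe.map σ (κ a b)
      ... | no _ = κ a b

      swapped-on : ∀ {a} b → OnChain a → swapped a b ≡ Maybe.map σ (κ a b)
      swapped-on {a} b a∈ with onChain? a
      ... | yes _ = refl
      ... | no a∉ = contradiction a∈ a∉

      swapped-off : ∀ {a} b → ¬ OnChain a → swapped a b ≡ κ a b
      swapped-off {a} b a∉ with onChain? a
      ... | yes a∈ = contradiction a∈ a∉
      ... | no _ = refl

    σ-fixes-boundary : ∀ {a b} → OnChain a → ¬ OnChain b → Maybe.map σ (κ a b) ≡ κ a b
    σ-fixes-boundary {a} {b} a∈ b∉ with κ a b in κab
    ... | nothing = refl
    ... | just c with transpose-moves-or-fixes α β c
    ...   | inj₁ c∈αβ = contradiction (chain-closed a∈ κab c∈αβ) b∉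
    ...   | inj₂ σc≡c = cong just σc≡c

    map-σ-just : ∀ {m : Maybe (Fin K)} {c} → Maybe.map σ m ≡ just c → m ≡ just (σ c)
    map-σ-just {just c₀} refl = cong just (sym (transpose-involutive α β c₀))

    on-chain-just : ∀ {a b c} → OnChain a → swapped a b ≡ just c → κ a b ≡ just (σ c)
    on-chain-just {b = b} a∈ eq = map-σ-just (trans (sym (swapped-on b a∈)) eq)

    off-chain-just : ∀ {a b c} → ¬ OnChain a → swapped a b ≡ just c → κ a b ≡ just c
    off-chain-just {b = b} a∉ eq = trans (sym (swapped-off b a∉)) eq

    swapped-just : ∀ {a b c} → swapped a b ≡ just c → ∃ λ c′ → κ a b ≡ just c′
    swapped-just {a} {b} {c} eq with onChain? a
    ... | yes a∈ = σ c , on-chain-just a∈ eq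
    ... | no a∉ = c , off-chain-just a∉ eq

    swapped-proper : Proper swapped
    symmetric swapped-proper a b with onChain? a | onChain? b
    ... | yes a∈ | yes b∈ = begin
      swapped a b          ≡⟨ swapped-on b a∈ ⟩
      Maybe.map σ (κ a b)  ≡⟨ cong (Maybe.map σ) (symmetric P a b) ⟩
      Maybe.map σ (κ b a)  ≡⟨ swapped-on a b∈ ⟨
      swapped b a          ∎
      where open ≡-Reasoning
    ... | yes a∈ | no b∉ = begin
      swapped a b          ≡⟨ swapped-on b a∈ ⟩
      Maybe.map σ (κ a b)  ≡⟨ σ-fixes-boundary a∈ b∉ ⟩
      κ a b                ≡⟨ symmetric P a b ⟩
      κ b a                ≡⟨ swapped-off a b∉ ⟨
      swapped b a          ∎
      where open ≡-Reasoning
    ... | no a∉ | yes b∈ = begin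
      swapped a b          ≡⟨ swapped-off b a∉ ⟩
      κ a b                ≡⟨ symmetric P a b ⟩
      κ b a                ≡⟨ σ-fixes-boundary b∈ a∉ ⟨
      Maybe.map σ (κ b a)  ≡⟨ swapped-on a b∈ ⟨
      swapped b a          ∎
      where open ≡-Reasoning
    ... | no a∉ | no b∉ = trans (swapped-off b a∉) (trans (symmetric P a b) (sym (swapped-off a b∉)))
    only-edges swapped-proper eq = only-edges P (proj₂ (swapped-just eq))
    injective swapped-proper {a} {b} {b′} eq eq′ with onChain? a
    ... | yes a∈ = injective P (on-chain-just a∈ eq) (on-chain-just a∈ eq′)
    ... | no a∉ = injective P (off-chain-just a∉ eq) (off-chain-just a∉ eq′)

    swapped-extends : Extends κ swapped
    swapped-extends {a} {b} (c , κab) with onChain? a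
    ... | yes a∈ = σ c , trans (swapped-on b a∈) (cong (Maybe.map σ) κab)
    ... | no a∉ = c , trans (swapped-off b a∉) κab

    swapped-missing-on : ∀ {v c} → OnChain v → Missing κ v c → Missing swapped v (σ c)
    swapped-missing-on {v} {c} v∈ c∉v b eq =
      c∉v b (trans (on-chain-just v∈ eq) (cong just (transpose-involutive α β c)))

    swapped-missing-off : ∀ {v c} → ¬ OnChain v → Missing κ v c → Missing swapped v c
    swapped-missing-off v∉ c∉v b eq = c∉v b (off-chain-just v∉ eq)

    swapped-missing-other : ∀ {v c} → c ≢ α → c ≢ β → Missing κ v c → Missing swapped v (σ c)
    swapped-missing-other {v} {c} c≢α c≢β c∉v with onChain? v
    ... | yes v∈ = swapped-missing-on v∈ c∉v
    ... | no v∉ rewrite transpose-other α β c≢α c≢β = swapped-missing-off v∉ c∉v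

    chain-stops-at : ∀ {y} → y ≢ x → Missing κ y β → OnChain y →
      ∃ λ j → chain j ≡ just y × chain (suc j) ≡ nothing
    chain-stops-at y≢x β∉y (zero , _ , refl) = contradiction refl y≢x
    chain-stops-at {y} y≢x β∉y (suc j , _ , yj) with chain-suc j yj
    ... | p , _ , κpy = suc j , yj , trans (cong (_>>= neighbour κ (colour (suc j))) yj) stop
      where
      arrival-is-α : colour j ≢ β
      arrival-is-α cj≡β = β∉y p (coloured-sym P (trans κpy (cong just cj≡β)))
      stop : neighbour κ (colour (suc j)) y ≡ nothing
      stop = missing⇒neighbour-nothing (subst (Missing κ y)
        (colour-other (suc j) (inj₂ refl) (λ β≡ → arrival-is-α (trans (sym (colour-ssuc j)) (sym β≡)))) β∉y)

    chain-endpoint-unique : ∀ {y y′} → y ≢ x → y′ ≢ x → Missing κ y β → Missing κ y′ β →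
      OnChain y → OnChain y′ → y ≡ y′
    chain-endpoint-unique y≢x y′≢x β∉y β∉y′ y∈ y′∈
      with chain-stops-at y≢x β∉y y∈ | chain-stops-at y′≢x β∉y′ y′∈
    ... | j , yj , stop | j′ , y′j′ , stop′ with <-cmp j j′
    ...   | tri≈ _ refl _ = just-injective (trans (sym yj) y′j′)
    ...   | tri< j<j′ _ _ with () ← trans (sym stop) (proj₂ (chain-prefix (suc j) j′ j<j′ y′j′))
    ...   | tri> _ _ j′<j with () ← trans (sym stop′) (proj₂ (chain-prefix (suc j′) j j′<j yj))

  module StarRecolouring {κ} (P : Proper κ) (u : Fin n) (R : Fin n → Maybe (Fin K))
    (R-only-edges : ∀ {b c} → R b ≡ just c → T (adj H u b))
    (R-injective : ∀ {b b′ c} → R b ≡ just c → R b′ ≡ just c → b ≡ b′)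
    (R-compatible : ∀ {a b c} → a ≢ u → R a ≡ just c → κ a b ≡ just c → u ≡ b) where

    opaque
      recoloured : Colouring
      recoloured a b with a ≟ u | b ≟ u
      ... | yes _ | _ = R b
      ... | no _ | yes _ = R a
      ... | no _ | no _ = κ a b

      recoloured-centre : ∀ b → recoloured u b ≡ R b
      recoloured-centre b with u ≟ u
      ... | yes _ = refl
      ... | no u≢u = contradiction refl u≢u

      recoloured-to-centre : ∀ {a} → a ≢ u → recoloured a u ≡ R a
      recoloured-to-centre {a} a≢u with a ≟ u | u ≟ u
      ... | yes a≡u | _ = contradiction a≡u a≢u
      ... | no _ | yes _ = refl
      ... | no _ | no u≢u = contradiction refl u≢u

      recoloured-elsewhere : ∀ {a b} → a ≢ u → b ≢ u → recoloured a b ≡ κ a b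
      recoloured-elsewhere {a} {b} a≢u b≢u with a ≟ u | b ≟ u
      ... | yes a≡u | _ = contradiction a≡u a≢u
      ... | no _ | yes b≡u = contradiction b≡u b≢u
      ... | no _ | no _ = refl

    data Position (a b : Fin n) : Set where
      from-centre : a ≡ u → recoloured a b ≡ R b → Position a b
      to-centre : a ≢ u → b ≡ u → recoloured a b ≡ R a → Position a b
      elsewhere : a ≢ u → b ≢ u → recoloured a b ≡ κ a b → Position a b

    position : ∀ a b → Position a b
    position a b with a ≟ u | b ≟ u
    ... | yes refl | _ = from-centre refl (recoloured-centre b)
    ... | no a≢u | yes refl = to-centre a≢u refl (recoloured-to-centre a≢u)
    ... | no a≢u | no b≢u = elsewhere a≢u b≢u (recoloured-elsewhere a≢u b≢u)

    recoloured-proper : Proper recoloured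
    symmetric recoloured-proper a b with position a b | position b a
    ... | from-centre refl r | from-centre refl r′ = trans r (sym r′)
    ... | from-centre refl r | to-centre _ refl r′ = trans r (sym r′)
    ... | to-centre _ refl r | from-centre refl r′ = trans r (sym r′)
    ... | elsewhere _ _ r | elsewhere _ _ r′ = trans r (trans (symmetric P a b) (sym r′))
    ... | from-centre a≡u _ | elsewhere _ a≢u _ = contradiction a≡u a≢u
    ... | to-centre _ b≡u _ | to-centre b≢u _ _ = contradiction b≡u b≢u
    ... | to-centre _ b≡u _ | elsewhere b≢u _ _ = contradiction b≡u b≢u
    ... | elsewhere _ b≢u _ | from-centre b≡u _ = contradiction b≡u b≢u
    ... | elsewhere a≢u _ _ | to-centre _ a≡u _ = contradiction a≡u a≢u
    only-edges recoloured-proper {a} {b} eq with position a b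
    ... | from-centre refl r = R-only-edges (trans (sym r) eq)
    ... | to-centre a≢u refl r = subst T (Graph.sym H u a) (R-only-edges (trans (sym r) eq))
    ... | elsewhere _ _ r = only-edges P (trans (sym r) eq)
    injective recoloured-proper {a} {b} {b′} eq eq′ with position a b | position a b′
    ... | from-centre refl r | from-centre _ r′ = R-injective (trans (sym r) eq) (trans (sym r′) eq′)
    ... | to-centre _ refl _ | to-centre _ refl _ = refl
    ... | to-centre a≢u refl r | elsewhere _ _ r′ = R-compatible a≢u (trans (sym r) eq) (trans (sym r′) eq′)
    ... | elsewhere a≢u _ r | to-centre _ refl r′ = sym (R-compatible a≢u (trans (sym r′) eq′) (trans (sym r) eq))
    ... | elsewhere _ _ r | elsewhere _ _ r′ = injective P (trans (sym r) eq) (trans (sym r′) eq′)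
    ... | from-centre a≡u _ | to-centre a≢u _ _ = contradiction a≡u a≢u
    ... | from-centre a≡u _ | elsewhere a≢u _ _ = contradiction a≡u a≢u
    ... | to-centre a≢u _ _ | from-centre a≡u _ = contradiction a≡u a≢u
    ... | elsewhere a≢u _ _ | from-centre a≡u _ = contradiction a≡u a≢u

    recoloured-extends : (∀ {b} → Coloured κ u b → ∃ λ c → R b ≡ just c) → Extends κ recoloured
    recoloured-extends R-keeps {a} {b} (c , κab) with position a b
    ... | from-centre refl r rewrite r = R-keeps (c , κab)
    ... | to-centre _ refl r rewrite r = R-keeps (c , coloured-sym P κab)
    ... | elsewhere _ _ r = c , trans r κab

  module FanRotation {κ} (P : Proper κ) (u : Fin n) (y : ℕ → Fin n) (L : ℕ)
    (y-injective : ∀ {i j} → i ≤ L → j ≤ L → y i ≡ y j → i ≡ j)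
    (φ : Fin n → Fin K) (γ : Fin K)
    (fan-colours : ∀ {j} → j < L → κ u (y (suc j)) ≡ just (φ (y j)))
    (φ-missing : ∀ {j} → j < L → Missing κ (y j) (φ (y j)))
    (γ-missing-at-u : Missing κ u γ) (γ-missing-at-last : Missing κ (y L) γ)
    (fan-adjacent : ∀ {j} → j ≤ L → T (adj H u (y j))) where

    InFan : Fin n → Set
    InFan b = ∃ λ j → j < L × y j ≡ b

    inFan? : ∀ b → Dec (InFan b)
    inFan? b = anyUpTo? (λ j → y j ≟ b) L

    -- u yⱼ takes the colour φ (y j) of u yⱼ₊₁ for j < L, and u y_L takes γ.
    rotation-of : ∀ {b} → Dec (b ≡ y L) → Dec (InFan b) → Maybe (Fin K)
    rotation-of (yes _) _ = just γ
    rotation-of {b} (no _) (yes _) = just (φ b)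
    rotation-of {b} (no _) (no _) = κ u b

    rotation : Fin n → Maybe (Fin K)
    rotation b = rotation-of (b ≟ y L) (inFan? b)

    data Spoke (b : Fin n) (r : Maybe (Fin K)) : Set where
      last-spoke : b ≡ y L → r ≡ just γ → Spoke b r
      fan-spoke : ∀ {j} → j < L → y j ≡ b → r ≡ just (φ b) → Spoke b r
      other-spoke : b ≢ y L → ¬ InFan b → r ≡ κ u b → Spoke b r

    spoke : ∀ b → Spoke b (rotation b)
    spoke b = classify (b ≟ y L) (inFan? b)
      where
      classify : (last? : Dec (b ≡ y L)) (fan? : Dec (InFan b)) → Spoke b (rotation-of last? fan?)
      classify (yes b≡last) _ = last-spoke b≡last refl
      classify (no _) (yes (_ , j<L , yj≡b)) = fan-spoke j<L yj≡b refl
      classify (no b≢last) (no b∉fan) = other-spoke b≢last b∉fan refl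

    successor-in-fan : ∀ {j b} → j < L → κ u b ≡ just (φ (y j)) → b ≢ y L → ¬ InFan b → ⊥
    successor-in-fan {j} j<L κub b≢last b∉fan with injective P κub (fan-colours j<L) | m≤n⇒m<n∨m≡n j<L
    ... | refl | inj₁ 1+j<L = b∉fan (suc j , 1+j<L , refl)
    ... | refl | inj₂ refl = b≢last refl

    same-colour : ∀ {p p′ q q′ z : Maybe (Fin K)} → p ≡ q → p′ ≡ q′ → p ≡ z → p′ ≡ z → q ≡ q′
    same-colour r r′ Rb Rb′ = trans (sym r) (trans Rb (trans (sym Rb′) r′))

    rotation-injective : ∀ {b b′ c} → rotation b ≡ just c → rotation b′ ≡ just c → b ≡ b′
    rotation-injective {b} {b′} Rb Rb′ with spoke b | spoke b′
    ... | last-spoke refl _ | last-spoke refl _ = refl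
    ... | last-spoke _ r | fan-spoke j<L refl r′ =
          ⊥-elim (γ-missing-at-u _ (trans (fan-colours j<L) (sym (same-colour r r′ Rb Rb′))))
    ... | fan-spoke j<L refl r | last-spoke _ r′ =
          ⊥-elim (γ-missing-at-u _ (trans (fan-colours j<L) (same-colour r r′ Rb Rb′)))
    ... | last-spoke _ r | other-spoke _ _ r′ = ⊥-elim (γ-missing-at-u b′ (sym (same-colour r r′ Rb Rb′)))
    ... | other-spoke _ _ r | last-spoke _ r′ = ⊥-elim (γ-missing-at-u b (same-colour r r′ Rb Rb′))
    ... | fan-spoke i<L refl r | fan-spoke j<L refl r′ = cong y (suc-injective (y-injective i<L j<L
          (injective P (fan-colours i<L) (trans (fan-colours j<L) (sym (same-colour r r′ Rb Rb′))))))
    ... | fan-spoke i<L refl r | other-spoke b′≢last b′∉fan r′ =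
          ⊥-elim (successor-in-fan i<L (sym (same-colour r r′ Rb Rb′)) b′≢last b′∉fan)
    ... | other-spoke b≢last b∉fan r | fan-spoke j<L refl r′ =
          ⊥-elim (successor-in-fan j<L (same-colour r r′ Rb Rb′) b≢last b∉fan)
    ... | other-spoke _ _ r | other-spoke _ _ r′ = injective P (trans (sym r) Rb) (trans (sym r′) Rb′)

    rotation-compatible : ∀ {a b c} → a ≢ u → rotation a ≡ just c → κ a b ≡ just c → u ≡ b
    rotation-compatible {a} {b} a≢u Ra κab with spoke a
    ... | last-spoke refl r = ⊥-elim (γ-missing-at-last b (trans κab (trans (sym Ra) r)))
    ... | fan-spoke j<L refl r = ⊥-elim (φ-missing j<L b (trans κab (trans (sym Ra) r)))
    ... | other-spoke _ _ r = injective P (coloured-sym P (trans (sym r) Ra)) κab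

    rotation-only-edges : ∀ {b c} → rotation b ≡ just c → T (adj H u b)
    rotation-only-edges {b} Rb with spoke b
    ... | last-spoke refl _ = fan-adjacent ≤-refl
    ... | fan-spoke j<L refl _ = fan-adjacent (<⇒≤ j<L)
    ... | other-spoke _ _ r = only-edges P (trans (sym r) Rb)

    rotation-keeps : ∀ {b} → Coloured κ u b → ∃ λ c → rotation b ≡ just c
    rotation-keeps {b} (c , κub) with spoke b
    ... | last-spoke _ r = γ , r
    ... | fan-spoke _ _ r = φ b , r
    ... | other-spoke _ _ r = c , trans r κub

    open StarRecolouring P u rotation rotation-only-edges rotation-injective rotation-compatible public

    rotated-extends : Extends κ recoloured
    rotated-extends = recoloured-extends rotation-keeps

    rotated-colours-first-spoke : Coloured recoloured u (y 0)
    rotated-colours-first-spoke with spoke (y 0)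
    ... | last-spoke _ r = γ , trans (recoloured-centre (y 0)) r
    ... | fan-spoke _ _ r = φ (y 0) , trans (recoloured-centre (y 0)) r
    ... | other-spoke y0≢last y0∉fan _ with m≤n⇒m<n∨m≡n (z≤n {L})
    ...   | inj₁ 0<L = contradiction (0 , 0<L , refl) y0∉fan
    ...   | inj₂ 0≡L = contradiction (cong y 0≡L) y0≢last

  colours-at : Colouring → Fin n → ℕ
  colours-at κ v = ∑[ c < K ] indicator (present? κ v c)

  class-size : Colouring → Fin K → ℕ
  class-size κ c = ∑[ v < n ] indicator (present? κ v c)

  module ColourClass {κ} (P : Proper κ) (c : Fin K) (x : Fin n) where

    mate : Fin n → Fin n
    mate = partner κ c

    mate-coloured : ∀ {v} → v ≢ mate v → κ v (mate v) ≡ just c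
    mate-coloured {v} v≢mv with neighbour κ c v in eq
    ... | just w = neighbour-just eq
    ... | nothing = contradiction refl v≢mv

    mate-involutive : ∀ {v} → v ≢ mate v → mate (mate v) ≡ v
    mate-involutive v≢mv = partner-of P (coloured-sym P (mate-coloured v≢mv))

    -- Each edge of colour c that avoids x is listed once, from its smaller endpoint.
    Lower : Fin n → Set
    Lower v = v Fin.< mate v × v ≢ x × mate v ≢ x

    lower? : ∀ v → Dec (Lower v)
    lower? v = (v Fin.<? mate v) ×-dec ¬? (v ≟ x) ×-dec ¬? (mate v ≟ x)

    lower≢mate : ∀ {v} → Lower v → v ≢ mate v
    lower≢mate (v<mv , _) v≡mv = Finₚ.<-irrefl v≡mv v<mv

    edge : Fin n → Fin n × Fin n
    edge v = v , mate v

    lowers : List (Fin n)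
    lowers = filter lower? (allFin n)

    matching : List (Fin n × Fin n)
    matching = map edge lowers

    ∈-covered⁻ : ∀ {z} vs → z ∈ covered (map edge vs) → ∃ λ w → w ∈ vs × (z ≡ w ⊎ z ≡ mate w)
    ∈-covered⁻ (w ∷ vs) (here z≡w) = w , here refl , inj₁ z≡w
    ∈-covered⁻ (w ∷ vs) (there (here z≡mw)) = w , here refl , inj₂ z≡mw
    ∈-covered⁻ (w ∷ vs) (there (there z∈)) with ∈-covered⁻ vs z∈
    ... | w′ , w′∈ , z≡ = w′ , there w′∈ , z≡

    ∈-covered⁺ : ∀ {w} vs → w ∈ vs → w ∈ covered (map edge vs) × mate w ∈ covered (map edge vs)
    ∈-covered⁺ (w ∷ vs) (here refl) = here refl , there (here refl)
    ∈-covered⁺ (_ ∷ vs) (there w∈) = Product.map (there ∘ there) (there ∘ there) (∈-covered⁺ vs w∈)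

    lower≢mate-of-lower : ∀ {v w} → Lower v → Lower w → v ≢ mate w
    lower≢mate-of-lower {v} {w} lv@(v<mv , _) lw@(w<mw , _) v≡mw =
      Finₚ.<-asym v<mv (subst₂ Fin._<_ (sym mv≡w) (sym v≡mw) w<mw)
      where
      mv≡w : mate v ≡ w
      mv≡w = trans (cong mate v≡mw) (mate-involutive (lower≢mate lw))

    mate-injective-on-lower : ∀ {v w} → Lower v → Lower w → mate v ≡ mate w → v ≡ w
    mate-injective-on-lower lv lw mv≡mw =
      trans (sym (mate-involutive (lower≢mate lv))) (trans (cong mate mv≡mw) (mate-involutive (lower≢mate lw)))

    covered-unique : ∀ vs → Unique vs → All Lower vs → Unique (covered (map edge vs))
    covered-unique [] _ _ = []
    covered-unique (v ∷ vs) (v∉vs ∷ vs!) (lv All.∷ lvs) =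
      (lower≢mate lv All.∷ All.tabulate v≢covered) ∷ All.tabulate mv≢covered ∷ covered-unique vs vs! lvs
      where
      v≢covered : ∀ {z} → z ∈ covered (map edge vs) → v ≢ z
      v≢covered z∈ with ∈-covered⁻ vs z∈
      ... | w , w∈ , inj₁ refl = All.lookup v∉vs w∈
      ... | w , w∈ , inj₂ refl = lower≢mate-of-lower lv (All.lookup lvs w∈)
      mv≢covered : ∀ {z} → z ∈ covered (map edge vs) → mate v ≢ z
      mv≢covered z∈ with ∈-covered⁻ vs z∈
      ... | w , w∈ , inj₁ refl = lower≢mate-of-lower (All.lookup lvs w∈) lv ∘ sym
      ... | w , w∈ , inj₂ refl = All.lookup v∉vs w∈ ∘ mate-injective-on-lower lv (All.lookup lvs w∈)

    lowers-lower : All Lower lowers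
    lowers-lower = All.tabulate (proj₂ ∘ ∈-filter⁻ lower? {xs = allFin n})

    matching-unique : Unique (covered matching)
    matching-unique = covered-unique lowers (Unique.filter⁺ lower? (Unique.allFin⁺ n)) lowers-lower

    matching-edges : All (λ { (a , b) → T (adj H a b) }) matching
    matching-edges = All.map⁺ (All.map (λ lv → only-edges P (mate-coloured (lower≢mate lv))) lowers-lower)

    x∉matching : x ∉ covered matching
    x∉matching x∈ with ∈-covered⁻ lowers x∈
    ... | w , w∈ , inj₁ x≡w = proj₁ (proj₂ (All.lookup lowers-lower w∈)) (sym x≡w)
    ... | w , w∈ , inj₂ x≡mw = proj₂ (proj₂ (All.lookup lowers-lower w∈)) (sym x≡mw)

    lower-at : ∀ {v b} → v Fin.< b → mate v ≡ b → v ≢ x → b ≢ x → Lower v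
    lower-at v<b refl v≢x b≢x = v<b , v≢x , b≢x

    lower∈lowers : ∀ {v} → Lower v → v ∈ lowers
    lower∈lowers {v} = ∈-filter⁺ lower? (∈-allFin v)

    incident⊆ : filter (λ v → present? κ v c) (allFin n) ⊆ x ∷ mate x ∷ covered matching
    incident⊆ {v} v∈ with proj₂ (∈-filter⁻ (λ v → present? κ v c) {xs = allFin n} v∈)
    ... | b , κvb with v ≟ x | b ≟ x
    ...   | yes refl | _ = here refl
    ...   | no _ | yes refl = there (here (sym (partner-of P (coloured-sym P κvb))))
    ...   | no v≢x | no b≢x with Finₚ.<-cmp v b
    ...     | tri< v<b _ _ =
      there (there (proj₁ (∈-covered⁺ lowers (lower∈lowers (lower-at v<b (partner-of P κvb) v≢x b≢x)))))
    ...     | tri≈ _ refl _ = contradiction κvb (loop-free P)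
    ...     | tri> _ _ b<v = there (there (subst (_∈ covered matching) mb≡v
      (proj₂ (∈-covered⁺ lowers (lower∈lowers (lower-at b<v mb≡v b≢x v≢x))))))
      where
      mb≡v : mate b ≡ v
      mb≡v = partner-of P (coloured-sym P κvb)

    class-size≤ : class-size κ c ≤ 2 + length (covered matching)
    class-size≤ = begin
      class-size κ c                                        ≡⟨ length-filter-allFin (λ v → present? κ v c) ⟨
      length (filter (λ v → present? κ v c) (allFin n))     ≤⟨ unique-⊆⇒length≤ incident! incident⊆ ⟩
      length (x ∷ mate x ∷ covered matching)                ∎
      where
      open ≤-Reasoning
      incident! : Unique (filter (λ v → present? κ v c) (allFin n))
      incident! = Unique.filter⁺ (λ v → present? κ v c) (Unique.allFin⁺ n)

  module _ {κ} (P : Proper κ) (total : Total κ) where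

    degree≤colours-at : ∀ v → degree H v ≤ colours-at κ v
    degree≤colours-at v = begin
      degree H v                                 ≤⟨ unique-⊆⇒length≤ neighbours! neighbours⊆ ⟩
      length (map (λ c → partner κ c v) present) ≡⟨ length-map _ present ⟩
      length present                             ≡⟨ length-filter-allFin (present? κ v) ⟩
      colours-at κ v                             ∎
      where
      open ≤-Reasoning
      present : List (Fin K)
      present = filter (present? κ v) (allFin K)
      neighbours! : Unique (filter (T? ∘ adj H v) (allFin n))
      neighbours! = Unique.filter⁺ (T? ∘ adj H v) (Unique.allFin⁺ n)
      neighbours⊆ : filter (λ u → T? (adj H v u)) (allFin n) ⊆ map (λ c → partner κ c v) present
      neighbours⊆ {b} b∈ with total (proj₂ (∈-filter⁻ (λ u → T? (adj H v u)) {xs = allFin n} b∈))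
      ... | c , κvb = subst (_∈ map (λ c → partner κ c v) present) (partner-of P κvb)
                        (∈-map⁺ (λ c → partner κ c v) (∈-filter⁺ (present? κ v) (∈-allFin c) (b , κvb)))

    degree-sum≤class-sizes : ∑[ v < n ] degree H v ≤ ∑[ c < K ] class-size κ c
    degree-sum≤class-sizes = begin
      ∑[ v < n ] degree H v       ≤⟨ ∑-mono-≤ degree≤colours-at ⟩
      ∑[ v < n ] colours-at κ v   ≡⟨ ∑-comm (λ v c → indicator (present? κ v c)) ⟩
      ∑[ c < K ] class-size κ c   ∎
      where open ≤-Reasoning

module Vizing {n} (H : Graph n) (D : ℕ) (degree≤D : ∀ v → degree H v ≤ D) where

  open EdgeColouring H (suc D)

  module ColourEdge {κ} (P : Proper κ) {u v₀} (uv₀ : T (adj H u v₀)) (uncoloured : κ u v₀ ≡ nothing) where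

    Extension : Set
    Extension = Σ Colouring λ κ′ → Proper κ′ × Extends κ κ′ × Coloured κ′ u v₀

    opaque
      free : Fin n → Fin (suc D)
      free v = proj₁ (missing-colour P v (s≤s (degree≤D v)))

      free-missing : ∀ v → Missing κ v (free v)
      free-missing v = proj₂ (missing-colour P v (s≤s (degree≤D v)))

    next : Fin n → Maybe (Fin n)
    next w = neighbour κ (free w) u

    -- The fan at u; the default of fromMaybe only matters once the fan Closes.
    y : ℕ → Fin n
    y zero = v₀
    y (suc j) = fromMaybe (y j) (next (y j))

    Closes : ℕ → Set
    Closes k = next (y k) ≡ nothing ⊎ ∃ λ i → i < suc k × next (y k) ≡ just (y i)

    closes? : ∀ k → Dec (Closes k)
    closes? k = ≡-decM _≟_ (next (y k)) nothing
      ⊎-dec anyUpTo? (λ i → ≡-decM _≟_ (next (y k)) (just (y i))) (suc k)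

    fan-step : ∀ {j} → ¬ Closes j → κ u (y (suc j)) ≡ just (free (y j))
    fan-step {j} open-at-j = via (next (y j)) refl
      where
      via : ∀ m → next (y j) ≡ m → κ u (fromMaybe (y j) m) ≡ just (free (y j))
      via nothing eq = contradiction (inj₁ eq) open-at-j
      via (just _) eq = neighbour-just eq

    fan-distinct : ∀ {k} → (∀ {j} → j < k → ¬ Closes j) → ∀ {a b} → a < b → b ≤ k → y a ≢ y b
    fan-distinct open-before {a} {suc b} a<1+b 1+b≤k ya≡y1+b with next (y b) in eq
    ... | nothing = open-before 1+b≤k (inj₁ eq)
    ... | just _ = open-before 1+b≤k (inj₂ (a , a<1+b , trans eq (cong just (sym ya≡y1+b))))

    fan-closes : ∃ λ k → k < suc n × Closes k
    fan-closes with anyUpTo? closes? (suc n)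
    ... | yes closing = closing
    ... | no never = contradiction (pigeonhole ≤-refl (y ∘ toℕ)) no-repeat
      where
      no-repeat : ¬ ∃₂ λ i j → i Fin.< j × y (toℕ i) ≡ y (toℕ j)
      no-repeat (i , j , i<j , same) =
        fan-distinct (λ {l} l<n c → never (l , m<n⇒m<1+n l<n , c)) i<j (≤-pred (Finₚ.toℕ<n j)) same

    module Closing {k} (open-before : ∀ {j} → j < k → ¬ Closes j) where

      fan-injective : ∀ {i j} → i ≤ k → j ≤ k → y i ≡ y j → i ≡ j
      fan-injective {i} {j} i≤k j≤k yi≡yj with <-cmp i j
      ... | tri< i<j _ _ = contradiction yi≡yj (fan-distinct open-before i<j j≤k)
      ... | tri≈ _ i≡j _ = i≡j
      ... | tri> _ _ j<i = contradiction (sym yi≡yj) (fan-distinct open-before j<i i≤k)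

      fan-colours : ∀ {j} → j < k → κ u (y (suc j)) ≡ just (free (y j))
      fan-colours j<k = fan-step (open-before j<k)

      fan-adjacent : ∀ {j} → j ≤ k → T (adj H u (y j))
      fan-adjacent {zero} _ = uv₀
      fan-adjacent {suc j} 1+j≤k = only-edges P (fan-colours 1+j≤k)

      fan-avoids-u : ∀ {j} → j ≤ k → y j ≢ u
      fan-avoids-u j≤k yj≡u = no-loop (subst (λ v → T (adj H u v)) yj≡u (fan-adjacent j≤k))

      rotate : ∀ {κ₁} → Proper κ₁ → Extends κ κ₁ → ∀ L → L ≤ k → (φ : Fin n → Fin (suc D)) (γ : Fin (suc D)) →
        (∀ {j} → j < L → κ₁ u (y (suc j)) ≡ just (φ (y j))) →
        (∀ {j} → j < L → Missing κ₁ (y j) (φ (y j))) →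
        Missing κ₁ u γ → Missing κ₁ (y L) γ → Extension
      rotate P₁ κ⊑κ₁ L L≤k φ γ φ-colours φ-missing γ-missing-at-u γ-missing-at-last =
        recoloured , recoloured-proper , (λ c → rotated-extends (κ⊑κ₁ c)) , rotated-colours-first-spoke
        where
        open FanRotation P₁ u y L (λ i≤L j≤L → fan-injective (≤-trans i≤L L≤k) (≤-trans j≤L L≤k))
          φ γ φ-colours φ-missing γ-missing-at-u γ-missing-at-last (λ j≤L → fan-adjacent (≤-trans j≤L L≤k))

      closes-at-missing : next (y k) ≡ nothing → Extension
      closes-at-missing none = rotate P (λ c → c) k ≤-refl free (free (y k)) fan-colours (λ _ → free-missing _)
        (neighbour-nothing none) (free-missing (y k))

      module ClosesEarlier {i} (i<k : i < k) (at-y1+i : next (y k) ≡ just (y (suc i))) where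

        α β : Fin (suc D)
        α = free u
        β = free (y k)
        κuy1+i : κ u (y (suc i)) ≡ just β
        κuy1+i = neighbour-just at-y1+i
        β-missing-at-yi : Missing κ (y i) β
        β-missing-at-yi = subst (Missing κ (y i)) (just-injective (trans (sym (fan-colours i<k)) κuy1+i))
          (free-missing (y i))
        α≢β : α ≢ β
        α≢β α≡β = free-missing u (y (suc i)) (trans κuy1+i (cong just (sym α≡β)))
        open KempeChain P u α≢β (free-missing u)
        β-missing-at-u : Missing swapped u β
        β-missing-at-u = subst (Missing swapped u) (transpose-i α β) (swapped-missing-on x-onChain (free-missing u))
        swapped-fan-colours : ∀ {j} → j < k → swapped u (y (suc j)) ≡ just (σ (free (y j)))
        swapped-fan-colours j<k = trans (swapped-on _ x-onChain) (cong (Maybe.map σ) (fan-colours j<k))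
        σ-free-missing-other : ∀ {j} → j < k → j ≢ i → Missing swapped (y j) (σ (free (y j)))
        σ-free-missing-other {j} j<k j≢i = swapped-missing-other free≢α free≢β (free-missing (y j))
          where
          free≢α : free (y j) ≢ α
          free≢α eq = free-missing u (y (suc j)) (trans (fan-colours j<k) (cong just eq))
          free≢β : free (y j) ≢ β
          free≢β eq = j≢i (suc-injective (fan-injective j<k i<k
            (injective P (trans (fan-colours j<k) (cong just eq)) κuy1+i)))

        -- After the swap β is missing at u, and y i, y k both miss β, so the chain from u contains
        -- at most one of them; the fan is rotated up to one that is off the chain.
        closes-at-earlier : Extension
        closes-at-earlier with onChain? (y i)
        ... | no yi∉ = rotate swapped-proper swapped-extends i (<⇒≤ i<k) (σ ∘ free) β σ-fan-colours
                         (λ j<i → σ-free-missing-other (<-trans j<i i<k) (<⇒≢ j<i)) β-missing-at-u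
                         (swapped-missing-off yi∉ β-missing-at-yi)
          where
          σ-fan-colours : ∀ {j} → j < i → swapped u (y (suc j)) ≡ just (σ (free (y j)))
          σ-fan-colours j<i = swapped-fan-colours (<-trans j<i i<k)
        ... | yes yi∈ = rotate swapped-proper swapped-extends k ≤-refl (σ ∘ free) β swapped-fan-colours
                          σ-free-missing (β-missing-at-u) (swapped-missing-off yk∉ (free-missing (y k)))
          where
          yk∉ : ¬ OnChain (y k)
          yk∉ yk∈ = fan-distinct open-before i<k ≤-refl (chain-endpoint-unique (fan-avoids-u (<⇒≤ i<k))
            (fan-avoids-u ≤-refl) β-missing-at-yi (free-missing (y k)) yi∈ yk∈)
          σ-free-missing : ∀ {j} → j < k → Missing swapped (y j) (σ (free (y j)))
          σ-free-missing {j} j<k with j ≟ℕ i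
          ... | yes refl = swapped-missing-on yi∈ (free-missing (y i))
          ... | no j≢i = σ-free-missing-other j<k j≢i

      close : Closes k → Extension
      close (inj₁ none) = closes-at-missing none
      close (inj₂ (zero , _ , at-v₀)) = contradiction (trans (sym uncoloured) (neighbour-just at-v₀)) λ ()
      close (inj₂ (suc i , 1+i<1+k , at-y1+i)) = ClosesEarlier.closes-at-earlier (≤-pred 1+i<1+k) at-y1+i

    colour-edge : Extension
    colour-edge with least-witness closes? (suc n) fan-closes
    ... | k , closes , open-before = Closing.close open-before closes

  colour-pair : ∀ {κ} → Proper κ → ∀ a b →
    Σ Colouring λ κ′ → Proper κ′ × Extends κ κ′ × (T (adj H a b) → Coloured κ′ a b)
  colour-pair {κ} P a b with κ a b in κab | T? (adj H a b)
  ... | just c | _ = κ , P , (λ c → c) , λ _ → c , κab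
  ... | nothing | no ¬ab = κ , P , (λ c → c) , λ ab → contradiction ab ¬ab
  ... | nothing | yes ab with ColourEdge.colour-edge P ab κab
  ...   | κ′ , P′ , κ⊑κ′ , ab-coloured = κ′ , P′ , κ⊑κ′ , λ _ → ab-coloured

  colour-pairs : ∀ {κ} → Proper κ → (ps : List (Fin n × Fin n)) →
    Σ Colouring λ κ′ → Proper κ′ × Extends κ κ′ × (∀ {a b} → (a , b) ∈ ps → T (adj H a b) → Coloured κ′ a b)
  colour-pairs {κ} P [] = κ , P , (λ c → c) , λ ()
  colour-pairs P ((a , b) ∷ ps) with colour-pair P a b
  ... | κ₁ , P₁ , κ⊑κ₁ , ab-coloured with colour-pairs P₁ ps
  ...   | κ₂ , P₂ , κ₁⊑κ₂ , ps-coloured = κ₂ , P₂ , (λ c → κ₁⊑κ₂ (κ⊑κ₁ c)) , λ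
          { (here refl) ab → κ₁⊑κ₂ (ab-coloured ab)
          ; (there ∈ps) ab → ps-coloured ∈ps ab }

  uncoloured-proper : Proper (λ _ _ → nothing)
  symmetric uncoloured-proper _ _ = refl
  only-edges uncoloured-proper ()
  injective uncoloured-proper ()

  vizing : Σ Colouring λ κ → Proper κ × Total κ
  vizing with colour-pairs uncoloured-proper (cartesianProduct (allFin n) (allFin n))
  ... | κ , P , _ , all-coloured =
    κ , P , λ {a} {b} → all-coloured (∈-cartesianProduct⁺ (∈-allFin a) (∈-allFin b))

  matching-avoiding : ∀ x → Σ (List (Fin n × Fin n)) λ M →
    (All (λ { (a , b) → T (adj H a b) }) M × Unique (covered M)) × x ∉ covered M ×
    ∑[ v < n ] degree H v ≤ suc D * (2 + length (covered M))
  matching-avoiding x with vizing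
  ... | κ , P , total with ∑≤length*max (class-size κ)
  ...   | c , ∑≤ = matching , (matching-edges , matching-unique) , x∉matching , degree-sum≤
    where
    open ColourClass P c x
    open ≤-Reasoning
    degree-sum≤ : ∑[ v < n ] degree H v ≤ suc D * (2 + length (covered matching))
    degree-sum≤ = begin
      (∑[ v < n ] degree H v)                    ≤⟨ degree-sum≤class-sizes P total ⟩
      (∑[ c < suc D ] class-size κ c)            ≤⟨ ∑≤ ⟩
      suc D * class-size κ c                     ≤⟨ *-monoʳ-≤ (suc D) class-size≤ ⟩
      suc D * (2 + length (covered matching))    ∎

∸-of-sum : ∀ {a b m} → suc (a + b) ≡ m → m ∸ suc a ≡ b
∸-of-sum {a} {b} refl = m+n∸m≡n (suc a) b

counting-bound : ∀ n k D S → n * D ≤ suc S → S ≤ suc D * (2 + k) → n * suc D ≤ (k + 3) * suc D + n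
counting-bound n k D S nD≤1+S S≤ = begin
  n * suc D                          ≡⟨ *-suc n D ⟩
  n + n * D                          ≤⟨ +-monoʳ-≤ n (≤-trans nD≤1+S (s≤s S≤)) ⟩
  n + suc X                          ≤⟨ +-monoʳ-≤ n (≤-trans (s≤s (m≤m+n X D)) (≤-reflexive (sym (+-suc X D)))) ⟩
  n + (X + suc D)                    ≡⟨ rearrange n k D ⟩
  (k + 3) * suc D + n                ∎
  where
  open ≤-Reasoning
  X : ℕ
  X = suc D * (2 + k)
  rearrange : ∀ n k D → n + (suc D * (2 + k) + suc D) ≡ (k + 3) * suc D + n
  rearrange = solve-∀

module AlmostRegularComplement {n} (r : ℕ) (G : Graph n) (x : Fin n) (almost-regular : AlmostRegularAt G r x) where

  D : ℕ
  D = n ∸ suc r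

  d : Fin n → ℕ
  d = degree (complement G)

  d-other : ∀ v → v ≢ x → d v ≡ D
  d-other v v≢x = sym (∸-of-sum (subst (λ e → suc (e + d v) ≡ n) (proj₂ almost-regular v v≢x)
    (degree+degree-complement G v)))

  1+d-x : suc (d x) ≡ D
  1+d-x = sym (∸-of-sum (trans (cong suc (+-suc r (d x)))
    (subst (λ e → suc (e + d x) ≡ n) (proj₁ almost-regular) (degree+degree-complement G x))))

  d≤D : ∀ v → d v ≤ D
  d≤D v with v ≟ x
  ... | yes refl = ≤-trans (n≤1+n _) (≤-reflexive 1+d-x)
  ... | no v≢x = ≤-reflexive (d-other v v≢x)

  n*D≤1+∑d : n * D ≤ suc (∑[ v < n ] d v)
  n*D≤1+∑d = *≤1+∑-except {f = d} x (λ v v≢x → ≤-reflexive (sym (d-other v v≢x))) (≤-reflexive (sym 1+d-x))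

  n∸r≡1+D : n ∸ r ≡ suc D
  n∸r≡1+D = +-∸-assoc 1 (<-trans (n<1+n r) (m∸n≢0⇒n<m {n} {suc r} D≢0))
    where
    D≢0 : D ≢ 0
    D≢0 D≡0 = 0≢1+n (trans (sym D≡0) (sym 1+d-x))

lemma2p5 : (n r : ℕ) (G : Graph n) (x : Fin n) → AlmostRegularAt G r x →
    Σ (List (Fin n × Fin n)) λ M → IsComplMatching G M × x ∉ covered M ×
      (n * (n ∸ r) ≤ (length (covered M) + 3) * (n ∸ r) + n)
lemma2p5 n r G x almost-regular
  with Vizing.matching-avoiding (complement G) _ (AlmostRegularComplement.d≤D r G x almost-regular) x
... | M , Ḡ-matching , x∉M , ∑d≤ = M , Ḡ-matching , x∉M ,
  subst (λ m → n * m ≤ (length (covered M) + 3) * m + n) (sym n∸r≡1+D)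
    (counting-bound n (length (covered M)) D _ n*D≤1+∑d ∑d≤)
  where open AlmostRegularComplement r G x almost-regular
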